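{- There is a ranked alphabet $\Sigma$ and a murg TRS $R$ over $\Sigma$ such that $R$ is not a P$\Sigma$RF-TRS.
   Context: A ranked alphabet $\Sigma$ is a finite set of symbols with ranks; $X$ a countable set of variables, $T_\Sigma(X)$ the terms, $T_\Sigma$ the ground terms; the height of a variable or constant is $0$. A TRS over $\Sigma$ is a finite set of rules $l\to r$, $l,r\in T_\Sigma(X)$, with every variable of $r$ occurring in $l$. A TRS is monadic if each left-hand side has height at least $1$ and each right-hand side has height at most $1$; right-ground if each right-hand side is ground; murg if it is the union of a monadic TRS and a right-ground TRS. $R^*_\Sigma(L)=\{p\mid q\Rightarrow^*_R p,\ q\in L\}$. A tree language is recognizable if recognized by a bottom-up tree automaton. $R$ is a P$\Sigma$RF-TRS if $R^*_\Sigma(L)$ is recognizable for every finite $L\subseteq T_\Sigma$. -}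

module Defs where

open import Data.Nat using (ℕ; zero; suc; _≤_; _⊔_)
open import Data.Fin using (Fin)
open import Data.Vec using (Vec; []; _∷_; _[_]≔_)
open import Data.Vec.Relation.Unary.Any using (Any)
open import Data.Vec.Relation.Binary.Pointwise.Inductive using (Pointwise)
open import Data.List using (List)
open import Data.List.Membership.Propositional using (_∈_)
open import Data.List.Relation.Unary.All using (All)
open import Data.Product using (Σ; Σ-syntax; ∃; ∃-syntax; _×_; _,_)
open import Data.Sum using (_⊎_)
open import Data.Bool using (Bool; true)
open import Data.Empty using (⊥)
open import Relation.Nullary using (¬_)
open import Relation.Binary.PropositionalEquality using (_≡_)
open import Relation.Binary.Construct.Closure.ReflexiveTransitive using (Star)
open import Function.Bundles using (_⇔_)

record RankedAlphabet : Set where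
  field
    size : ℕ
    rank : Fin size → ℕ
open RankedAlphabet public

Var : Set
Var = ℕ

module _ (Sig : RankedAlphabet) where

  -- Terms over Sig with variables from V.
  -- T_Σ(X) = Term Var ;  ground terms T_Σ = Term ⊥.
  data Term (V : Set) : Set where
    var : V → Term V
    app : (f : Fin (size Sig)) → Vec (Term V) (rank Sig f) → Term V

  -- height: variables and constants have height 0.
  mutual
    height : {V : Set} → Term V → ℕ
    height (var x) = 0
    height (app f ts) = heightApp ts

    heightApp : {V : Set} {k : ℕ} → Vec (Term V) k → ℕ
    heightApp [] = 0
    heightApp (t ∷ ts) = suc (heightV (t ∷ ts))

    heightV : {V : Set} {k : ℕ} → Vec (Term V) k → ℕ
    heightV [] = 0
    heightV (t ∷ ts) = height t ⊔ heightV ts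

  data _occursIn_ (x : Var) : Term Var → Set where
    here : x occursIn var x
    under : ∀ {f ts} → Any (x occursIn_) ts → x occursIn app f ts

  mutual
    subst : (Var → Term ⊥) → Term Var → Term ⊥
    subst σ (var x) = σ x
    subst σ (app f ts) = app f (substV σ ts)

    substV : {k : ℕ} → (Var → Term ⊥) → Vec (Term Var) k → Vec (Term ⊥) k
    substV σ [] = []
    substV σ (t ∷ ts) = subst σ t ∷ substV σ ts

  Rule : Set
  Rule = Term Var × Term Var

  lhs rhs : Rule → Term Var
  lhs (l , r) = l
  rhs (l , r) = r

  record TRS : Set where
    field
      rules : List Rule
      varCond : All (λ ρ → ∀ x → x occursIn rhs ρ → x occursIn lhs ρ) rules
  open TRS public

  MonadicRule : Rule → Set
  MonadicRule (l , r) = 1 ≤ height l × height r ≤ 1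

  RightGroundRule : Rule → Set
  RightGroundRule (l , r) = ∀ x → ¬ (x occursIn r)

  Monadic : TRS → Set
  Monadic R = All MonadicRule (rules R)

  RightGround : TRS → Set
  RightGround R = All RightGroundRule (rules R)

  Murg : TRS → Set
  Murg R = Σ[ R₁ ∈ TRS ] Σ[ R₂ ∈ TRS ]
             Monadic R₁ × RightGround R₂ ×
             (∀ ρ → (ρ ∈ rules R) ⇔ (ρ ∈ rules R₁ ⊎ ρ ∈ rules R₂))

  data Step (R : TRS) : Term ⊥ → Term ⊥ → Set where
    root : ∀ {ρ} → ρ ∈ rules R → (σ : Var → Term ⊥) →
           Step R (subst σ (lhs ρ)) (subst σ (rhs ρ))
    inside : ∀ {f} (ts : Vec (Term ⊥) (rank Sig f)) (i : Fin (rank Sig f)) {t t′} →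
             Step R t t′ → Step R (app f (ts [ i ]≔ t)) (app f (ts [ i ]≔ t′))

  Language : Set₁
  Language = Term ⊥ → Set

  Descendants : TRS → List (Term ⊥) → Language
  Descendants R L p = ∃[ q ] (q ∈ L × Star (Step R) q p)

  record TreeAutomaton : Set where
    field
      states : ℕ
      δ : (f : Fin (size Sig)) → Vec (Fin states) (rank Sig f) → Fin states → Bool
      final : Fin states → Bool
  open TreeAutomaton public

  data Reaches (A : TreeAutomaton) : Term ⊥ → Fin (states A) → Set where
    step : ∀ {f ts q} (qs : Vec (Fin (states A)) (rank Sig f)) →
           Pointwise (Reaches A) ts qs → δ A f qs q ≡ true →
           Reaches A (app f ts) q

  Accepts : TreeAutomaton → Term ⊥ → Set
  Accepts A t = ∃[ q ] (Reaches A t q × final A q ≡ true)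

  Recognizable : Language → Set
  Recognizable L = ∃[ A ] (∀ t → L t ⇔ Accepts A t)

  PΣRF : TRS → Set
  PΣRF R = ∀ (L : List (Term ⊥)) → Recognizable (Descendants R L)

-- Over the alphabet {e, e′, d : 0; s : 1; k, k′ : 2} take the monadic rule
-- k(x, x) → k′(x, x) together with the right-ground rules
-- e → s(e), e → d, e′ → s(e′), e′ → d.  From the single term k(e, e′) one
-- reaches k′(sⁿ(d), sⁿ(d)) for every n, but never k′(sⁱ(d), sʲ(d)) with i ≢ j:
-- the arguments of k stay towers over e and over e′ respectively, k(x, x)
-- fires only once both have become the same numeral sⁿ(d), and numerals are
-- normal forms.  A tree automaton, on the other hand, accepting all the
-- diagonal terms k′(sⁿ(d), sⁿ(d)) assigns the same state to two different
-- numerals (pigeonhole) and hence also accepts an off-diagonal term.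
module Submission where

open import Defs
open import Data.Product using (Σ-syntax; _×_; _,_; ∃-syntax; proj₁; proj₂)
open import Relation.Nullary using (¬_)

open import Data.Nat using (ℕ; zero; suc; s≤s; z≤n)
open import Data.Nat.Properties using (n<1+n; <⇒≢)
open import Data.Fin using (Fin; zero; suc; toℕ) renaming (_<_ to _<ᶠ_)
open import Data.Fin.Properties using (pigeonhole)
open import Data.Vec using (Vec; []; _∷_; _[_]≔_)
import Data.Vec.Relation.Unary.Any as VecAny
open import Data.Vec.Relation.Binary.Pointwise.Inductive using ([]; _∷_)
open import Data.List using (List; []; _∷_; _++_; map)
open import Data.List.Relation.Unary.Any using (here; there)
open import Data.List.Membership.Propositional using (_∈_)
open import Data.List.Membership.Propositional.Properties using (++-∈⇔)
open import Data.List.Relation.Unary.All using (All; []; _∷_)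
import Data.List.Relation.Unary.All as All
open import Data.List.Relation.Unary.All.Properties using (++⁺)
open import Data.Unit using (⊤; tt)
open import Data.Empty using (⊥; ⊥-elim)
open import Relation.Binary.PropositionalEquality using (_≡_; refl; cong) renaming (subst to transport)
open import Relation.Binary.Construct.Closure.ReflexiveTransitive
  using (Star; ε; _◅_; _◅◅_; gmap)
open import Function.Bundles using (Equivalence)

module _ {Sig : RankedAlphabet} where

  _∪_ : TRS Sig → TRS Sig → TRS Sig
  R₁ ∪ R₂ = record { rules = rules R₁ ++ rules R₂
                   ; varCond = ++⁺ (varCond R₁) (varCond R₂) }

  union-murg : ∀ R₁ R₂ → Monadic Sig R₁ → RightGround Sig R₂ → Murg Sig (R₁ ∪ R₂)
  union-murg R₁ R₂ monadic rightGround = R₁ , R₂ , monadic , rightGround , λ _ → ++-∈⇔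

  mutual
    embed : Term Sig ⊥ → Term Sig Var
    embed (app f ts) = app f (embedV ts)

    embedV : ∀ {k} → Vec (Term Sig ⊥) k → Vec (Term Sig Var) k
    embedV [] = []
    embedV (t ∷ ts) = embed t ∷ embedV ts

  mutual
    embed-noVar : (t : Term Sig ⊥) → ∀ x → ¬ (_occursIn_ Sig x (embed t))
    embed-noVar (app f ts) x (under occ) = embedV-noVar ts x occ

    embedV-noVar : ∀ {k} (ts : Vec (Term Sig ⊥) k) x →
                   ¬ VecAny.Any (_occursIn_ Sig x) (embedV ts)
    embedV-noVar (t ∷ ts) x (VecAny.here occ) = embed-noVar t x occ
    embedV-noVar (t ∷ ts) x (VecAny.there occ) = embedV-noVar ts x occ

  groundRule : Term Sig Var × Term Sig ⊥ → Rule Sig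
  groundRule (l , r) = l , embed r

  groundRules-rightGround : ∀ rs → All (RightGroundRule Sig) (map groundRule rs)
  groundRules-rightGround [] = []
  groundRules-rightGround ((l , r) ∷ rs) = embed-noVar r ∷ groundRules-rightGround rs

  rightGroundTRS : List (Term Sig Var × Term Sig ⊥) → TRS Sig
  rightGroundTRS rs = record
    { rules = map groundRule rs
    ; varCond = All.map (λ noVar x occ → ⊥-elim (noVar x occ)) (groundRules-rightGround rs) }

  inside⋆ : ∀ {R f} (ts : Vec (Term Sig ⊥) (rank Sig f)) (i : Fin (rank Sig f)) {t t′} →
            Star (Step Sig R) t t′ →
            Star (Step Sig R) (app f (ts [ i ]≔ t)) (app f (ts [ i ]≔ t′))
  inside⋆ {f = f} ts i = gmap (λ t → app f (ts [ i ]≔ t)) (Step.inside ts i)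

pattern e  = zero
pattern e′ = suc zero
pattern d  = suc (suc zero)
pattern s  = suc (suc (suc zero))
pattern k  = suc (suc (suc (suc zero)))
pattern k′ = suc (suc (suc (suc (suc zero))))

arity : Fin 6 → ℕ
arity e  = 0
arity e′ = 0
arity d  = 0
arity s  = 1
arity k  = 2
arity k′ = 2

Σ₀ : RankedAlphabet
Σ₀ = record { size = 6 ; rank = arity }

T : Set
T = Term Σ₀ ⊥

E E′ D : ∀ {V} → Term Σ₀ V
E  = app e []
E′ = app e′ []
D  = app d []

S : ∀ {V} → Term Σ₀ V → Term Σ₀ V
S u = app s (u ∷ [])

K K′ : ∀ {V} → Term Σ₀ V → Term Σ₀ V → Term Σ₀ V
K u v = app k (u ∷ v ∷ [])
K′ u v = app k′ (u ∷ v ∷ [])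

monadicPart : TRS Σ₀
monadicPart = record { rules = (K (var 0) (var 0) , K′ (var 0) (var 0)) ∷ []
                     ; varCond = (λ { x (under occ) → under occ }) ∷ [] }

monadicPart-monadic : Monadic Σ₀ monadicPart
monadicPart-monadic = (s≤s z≤n , s≤s z≤n) ∷ []

rightGroundPart : TRS Σ₀
rightGroundPart = rightGroundTRS ((E , S E) ∷ (E , D) ∷ (E′ , S E′) ∷ (E′ , D) ∷ [])

R : TRS Σ₀
R = monadicPart ∪ rightGroundPart

R-murg : Murg Σ₀ R
R-murg = union-murg monadicPart rightGroundPart monadicPart-monadic
                    (groundRules-rightGround _)

_⇒_ _⇒⋆_ : T → T → Set
_⇒_ = Step Σ₀ R
_⇒⋆_ = Star _⇒_

pattern k→k′ = here refl
pattern e→se = there (here refl)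
pattern e→d = there (there (here refl))
pattern e′→se′ = there (there (there (here refl)))
pattern e′→d = there (there (there (there (here refl))))
pattern no-rule = there (there (there (there (there ()))))

num : ℕ → T
num zero = D
num (suc n) = S (num n)

num-injective : ∀ {i j} → num i ≡ num j → i ≡ j
num-injective {zero} {zero} eq = refl
num-injective {suc i} {suc j} eq = cong suc (num-injective (cong argument eq))
  where
  argument : T → T
  argument (app s (u ∷ [])) = u
  argument u = u

under-s : ∀ {u v} → u ⇒⋆ v → S u ⇒⋆ S v
under-s = inside⋆ {f = s} (D ∷ []) zero

e⇒⋆num : ∀ n → E ⇒⋆ num n
e⇒⋆num zero = root e→d (λ _ → D) ◅ ε
e⇒⋆num (suc n) = root e→se (λ _ → D) ◅ under-s (e⇒⋆num n)

e′⇒⋆num : ∀ n → E′ ⇒⋆ num n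
e′⇒⋆num zero = root e′→d (λ _ → D) ◅ ε
e′⇒⋆num (suc n) = root e′→se′ (λ _ → D) ◅ under-s (e′⇒⋆num n)

start : T
start = K E E′

start⇒⋆diagonal : ∀ n → start ⇒⋆ K′ (num n) (num n)
start⇒⋆diagonal n =
  inside⋆ {f = k} (D ∷ E′ ∷ []) zero (e⇒⋆num n) ◅◅
  inside⋆ {f = k} (num n ∷ D ∷ []) (suc zero) (e′⇒⋆num n) ◅◅
  root k→k′ (λ _ → num n) ◅ ε

-- Tower c t: t is sⁿ(c) or sⁿ(d), for a constant c ∈ {e, e′}.  These are
-- exactly the reducts of c, and the set is closed under rewriting.
Tower : Fin 6 → T → Set
Tower c (app e []) = c ≡ e
Tower c (app e′ []) = c ≡ e′
Tower c (app d []) = ⊤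
Tower c (app s (u ∷ [])) = Tower c u
Tower c _ = ⊥

tower-step : ∀ c {u u′} → u ⇒ u′ → Tower c u → Tower c u′
tower-step c (root k→k′ σ) ()
tower-step c (root e→se σ) c≡e = c≡e
tower-step c (root e→d σ) _ = tt
tower-step c (root e′→se′ σ) c≡e′ = c≡e′
tower-step c (root e′→d σ) _ = tt
tower-step c (inside {s} (_ ∷ []) zero inner) tower = tower-step c inner tower

Numeral : T → Set
Numeral (app d []) = ⊤
Numeral (app s (u ∷ [])) = Numeral u
Numeral _ = ⊥

numeral-normal : ∀ {u u′} → u ⇒ u′ → ¬ Numeral u
numeral-normal (root k→k′ σ) ()
numeral-normal (root e→se σ) ()
numeral-normal (root e→d σ) ()
numeral-normal (root e′→se′ σ) ()
numeral-normal (root e′→d σ) ()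
numeral-normal (root no-rule σ)
numeral-normal (inside {s} (_ ∷ []) zero inner) numeral = numeral-normal inner numeral

towers⇒numeral : ∀ u → Tower e u → Tower e′ u → Numeral u
towers⇒numeral (app d []) _ _ = tt
towers⇒numeral (app s (u ∷ [])) tower tower′ = towers⇒numeral u tower tower′
towers⇒numeral (app e []) _ ()
towers⇒numeral (app e′ []) () _

-- The invariant of the descendants of k(e, e′): either k(u, v) with u a
-- tower over e and v a tower over e′, or k′(u, u) with u a numeral.
Shape : T → Set
Shape (app k (u ∷ v ∷ [])) = Tower e u × Tower e′ v
Shape (app k′ (u ∷ v ∷ [])) = u ≡ v × Numeral u
Shape _ = ⊥

shape-step : ∀ {u u′} → u ⇒ u′ → Shape u → Shape u′
shape-step (root k→k′ σ) (tower , tower′) = refl , towers⇒numeral (σ 0) tower tower′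
shape-step (root e→se σ) ()
shape-step (root e→d σ) ()
shape-step (root e′→se′ σ) ()
shape-step (root e′→d σ) ()
shape-step (root no-rule σ)
shape-step (inside {k} (_ ∷ _ ∷ []) zero inner) (tower , tower′) =
  tower-step e inner tower , tower′
shape-step (inside {k} (_ ∷ _ ∷ []) (suc zero) inner) (tower , tower′) =
  tower , tower-step e′ inner tower′
shape-step (inside {k′} (_ ∷ _ ∷ []) zero inner) (_ , numeral) =
  ⊥-elim (numeral-normal inner numeral)
shape-step (inside {k′} (_ ∷ _ ∷ []) (suc zero) inner) (refl , numeral) =
  ⊥-elim (numeral-normal inner numeral)

shape-steps : ∀ {u u′} → u ⇒⋆ u′ → Shape u → Shape u′
shape-steps ε shape = shape
shape-steps (first ◅ rest) shape = shape-steps rest (shape-step first shape)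

descendants-diagonal : ∀ {i j} → Descendants Σ₀ R (start ∷ []) (K′ (num i) (num j)) → i ≡ j
descendants-diagonal (_ , here refl , steps) =
  num-injective (proj₁ (shape-steps steps (refl , refl)))

left-state : ∀ (A : TreeAutomaton Σ₀) {u v} → Accepts Σ₀ A (K′ u v) →
             Σ[ q ∈ Fin (states A) ] (Reaches Σ₀ A u q ×
               (∀ {u′} → Reaches Σ₀ A u′ q → Accepts Σ₀ A (K′ u′ v)))
left-state A (q , step (ql ∷ qr ∷ []) (run-u ∷ run-v ∷ []) transition , final) =
  ql , run-u , λ run-u′ → q , step (ql ∷ qr ∷ []) (run-u′ ∷ run-v ∷ []) transition , final

-- Pumping: an automaton accepting k′(uₙ, vₙ) for every n also accepts some
-- k′(uᵢ, vⱼ) with i ≢ j, since two of the left states must coincide.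
pumping : ∀ (A : TreeAutomaton Σ₀) (u v : ℕ → T) →
          (∀ n → Accepts Σ₀ A (K′ (u n) (v n))) →
          ∃[ i ] ∃[ j ] (¬ i ≡ j × Accepts Σ₀ A (K′ (u i) (v j)))
pumping A u v accepts = collide (pigeonhole (n<1+n (states A)) (λ n → state (toℕ n)))
  where
  state : ∀ n → Fin (states A)
  state n = proj₁ (left-state A (accepts n))

  reaches : ∀ n → Reaches Σ₀ A (u n) (state n)
  reaches n = proj₁ (proj₂ (left-state A (accepts n)))

  replace : ∀ n {u′} → Reaches Σ₀ A u′ (state n) → Accepts Σ₀ A (K′ u′ (v n))
  replace n = proj₂ (proj₂ (left-state A (accepts n)))

  collide : ∃[ i ] ∃[ j ] (i <ᶠ j × state (toℕ i) ≡ state (toℕ j)) →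
            ∃[ i ] ∃[ j ] (¬ i ≡ j × Accepts Σ₀ A (K′ (u i) (v j)))
  collide (i , j , i<j , same-state) =
    toℕ i , toℕ j , <⇒≢ i<j ,
    replace (toℕ j) (transport (Reaches Σ₀ A (u (toℕ i))) same-state (reaches (toℕ i)))

R-not-PΣRF : ¬ PΣRF Σ₀ R
R-not-PΣRF recognizable
  with A , L⇔A ← recognizable (start ∷ [])
  with i , j , i≢j , accepts-off-diagonal ←
         pumping A num num (λ n → Equivalence.to (L⇔A _) (start , here refl , start⇒⋆diagonal n))
  = i≢j (descendants-diagonal (Equivalence.from (L⇔A _) accepts-off-diagonal))

mainTheorem13 : Σ[ Sig ∈ RankedAlphabet ] Σ[ R ∈ TRS Sig ] (Murg Sig R × ¬ PΣRF Sig R)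
mainTheorem13 = Σ₀ , R , R-murg , R-not-PΣRF
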